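{- For the rhombus game on the triangular grid with $n$ winning sets, $\mathrm{SC}_2(\mathcal G_{\lozenge},3)\ge \frac{7n}{96}-o(n)$.
   Context: An $s$-of-$k$ game on a $k$-uniform hypergraph $(V,\mathcal F)$ (winning sets are $k$-element subsets of the finite set $V$), $1\le s\le k$: Maker and Breaker alternately claim unclaimed vertices, Maker first, until all are claimed; the score is the number of winning sets in which Maker claimed at least $s$ vertices (Maker maximizes, Breaker minimizes). A pairing strategy for Maker: she fixes in advance pairwise disjoint pairs of vertices and, whenever Breaker claims a vertex of a pair whose partner is unclaimed, she claims the partner (other moves arbitrary). $\mathrm{SC}_2(\mathcal H,s)$ is the largest score Maker can guarantee against every Breaker strategy using a pairing strategy. $\mathcal G_{\lozenge}$ is the hypergraph whose vertices are the points of a finite portion of the triangular lattice and whose winning sets are the vertex sets of all rhombi formed by two unit triangles sharing an edge, in all three orientations, so $k=4$. Grids are assumed "two-dimensional": the number of winning sets within constant distance of the boundary is $o(n)$, where $n$ is the number of winning sets; $o(n)$ refers to $n\to\infty$. -}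

module Defs where

open import Data.Nat as ℕ using (ℕ; zero; suc; _≤_; _+_; _*_)
import Data.Nat.Properties as ℕP
open import Data.Integer as ℤ using (ℤ; +_)
import Data.Integer.Properties as ℤP
open import Data.Product using (_×_; _,_; Σ; ∃; ∃-syntax)
open import Data.Product.Properties using (≡-dec)
open import Data.Sum using (_⊎_)
import Data.List.Membership.Propositional as Mem
import Data.Unit
open import Data.Maybe using (Maybe; just)
open import Data.List using (List; []; _∷_; length; filter; map; concatMap; upTo; head)
open import Data.List.Relation.Unary.All using (All; all?)
open import Data.List.Relation.Unary.Unique.Propositional using (Unique)
open import Data.List.Relation.Binary.Permutation.Propositional using (_↭_)
open import Relation.Binary.PropositionalEquality using (_≡_; _≢_)
open import Relation.Binary.Definitions using (DecidableEquality)
open import Relation.Nullary using (¬_)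
open import Relation.Nullary.Decidable using (¬?)

-- Points of the triangular lattice, in axial coordinates:
-- (a , b) stands for a·e₁ + b·e₂ with e₁, e₂ unit vectors at 60°.
-- The six neighbours of (a,b) are (a±1,b), (a,b±1), (a+1,b-1), (a-1,b+1).

Pt : Set
Pt = ℤ × ℤ

_≟ₚ_ : DecidableEquality Pt
_≟ₚ_ = ≡-dec ℤP._≟_ ℤP._≟_

open import Data.List.Membership.DecPropositional _≟ₚ_ public
  using (_∈_; _∉_; _∈?_)

-- Rhombi: two unit triangles sharing an edge, in the three orientations.
-- Unit triangles are {(a,b),(a+1,b),(a,b+1)} and {(a+1,b),(a,b+1),(a+1,b+1)}.

data Orientation : Set where
  o₁ o₂ o₃ : Orientation

orientations : List Orientation
orientations = o₁ ∷ o₂ ∷ o₃ ∷ []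

shift : Pt → ℤ → ℤ → Pt
shift (a , b) x y = (a ℤ.+ x , b ℤ.+ y)

rhombus : Pt → Orientation → List Pt
rhombus p o₁ = p ∷ shift p (+ 1) (+ 0) ∷ shift p (+ 0) (+ 1) ∷ shift p (+ 1) (+ 1) ∷ []
rhombus p o₂ = p ∷ shift p (+ 1) (+ 0) ∷ shift p (+ 0) (+ 1) ∷ shift p (+ 1) (ℤ.- (+ 1)) ∷ []
rhombus p o₃ = p ∷ shift p (+ 1) (+ 0) ∷ shift p (+ 0) (+ 1) ∷ shift p (ℤ.- (+ 1)) (+ 1) ∷ []

candidates : List Pt → List (List Pt)
candidates V = concatMap (λ p → map (rhombus p) orientations) V

-- the winning sets of G_◇ on the finite portion V: rhombi contained in V
-- (each such rhombus occurs exactly once when V has no duplicates)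
winningSets : List Pt → List (List Pt)
winningSets V = filter (λ r → all? (_∈? V) r) (candidates V)

numWin : List Pt → ℕ
numWin V = length (winningSets V)

range : ℕ → List ℤ
range d = map (λ i → + i ℤ.- + d) (upTo (suc (d + d)))

-- closed ball of graph-radius d around p in the triangular lattice:
-- points p + (x,y) with max(|x|,|y|,|x+y|) ≤ d
ball : ℕ → Pt → List Pt
ball d p = filter (λ q → ℤ.∣ (Data.Product.proj₁ q ℤ.- Data.Product.proj₁ p)
                               ℤ.+ (Data.Product.proj₂ q ℤ.- Data.Product.proj₂ p) ∣ ℕ.≤? d)
                  (concatMap (λ x → map (λ y → shift p x y) (range d)) (range d))

-- a winning set is d-interior in V if every lattice point within distance d
-- of it belongs to V; otherwise it lies within distance d of the boundary
interior : ℕ → List Pt → List Pt → Set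
interior d V r = All (λ v → All (_∈ V) (ball d v)) r

interior? : (d : ℕ) (V r : List Pt) → Relation.Nullary.Dec (interior d V r)
interior? d V r = all? (λ v → all? (_∈? V) (ball d v)) r

nearBoundary : ℕ → List Pt → ℕ
nearBoundary d V = length (filter (λ r → ¬? (interior? d V r)) (winningSets V))

-- Maker moves first: her vertices are those at positions 0, 2, 4, ...
makerPart breakerPart : List Pt → List Pt
makerPart [] = []
makerPart (x ∷ xs) = x ∷ breakerPart xs
breakerPart [] = []
breakerPart (x ∷ xs) = makerPart xs

claimedIn : List Pt → List Pt → ℕ
claimedIn M r = length (filter (_∈? M) r)

score : ℕ → List Pt → List Pt → ℕ
score s V play = length (filter (λ r → s ℕ.≤? claimedIn (makerPart play) r) (winningSets V))

Pairing : Set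
Pairing = List (Pt × Pt)

pairVertices : Pairing → List Pt
pairVertices P = concatMap (λ uv → Data.Product.proj₁ uv ∷ Data.Product.proj₂ uv ∷ []) P

ValidPairing : List Pt → Pairing → Set
ValidPairing V P = All (λ uv → (Data.Product.proj₁ uv ∈ V) × (Data.Product.proj₂ uv ∈ V)) P
                 × Unique (pairVertices P)

Partner : Pairing → Pt → Pt → Set
Partner P v w = ((v , w) Mem.∈ P) ⊎ ((w , v) Mem.∈ P)

-- A complete play is a list of all vertices in order of claiming.
-- FollowsPairing P claimed makerToMove rest: every Breaker move on a vertex
-- whose partner is still unclaimed is immediately answered by Maker taking
-- that partner.  (Other moves of both players are unrestricted.)
FollowsPairing : Pairing → List Pt → ℕ → List Pt → Set
FollowsPairing P c t [] = Data.Unit.⊤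
FollowsPairing P c zero (v ∷ rest) = FollowsPairing P (v ∷ c) 1 rest
FollowsPairing P c (suc _) (v ∷ rest) =
  (∀ w → Partner P v w → w ∉ c → head rest ≡ just w) × FollowsPairing P (v ∷ c) 0 rest

PlayFollowing : List Pt → Pairing → List Pt → Set
PlayFollowing V P play = (play ↭ V) × FollowsPairing P [] 0 play

PairingGuarantees : ℕ → List Pt → Pairing → ℕ → Set
PairingGuarantees s V P t = ∀ play → PlayFollowing V P play → t ≤ score s V play

SC₂≥ : ℕ → List Pt → ℕ → Set
SC₂≥ s V t = ∃[ P ] (ValidPairing V P × PairingGuarantees s V P t)

module Submission where

-- Pair each point whose column is 0 or 1 (mod 4) with the point two steps to its right, and cut the
-- grid into cells of 32 × 2 points based at points whose first coordinate is ≡ 0 (mod 32).  A cell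
-- inside V consists of eight 4 × 2 blocks in a row.  Whatever Breaker does, the pairing gives Maker a
-- vertex of every pair, and a potential function on pairs of consecutive blocks (checked on all
-- 3⁴ · 3⁴ admissible configurations) shows that at least 7 of the 61 rhombi of the cell in
-- orientations o₁ and o₃ get three Maker vertices.  Different cells share no rhombus, every interior
-- point (one whose ball of radius 32 lies in V) is in the bottom row of a cell inside V, and every
-- winning set is one of the three rhombi anchored at its first vertex, which is interior unless the
-- rhombus is near the boundary.  Hence the score is at least
-- 7 · #cells ≥ 7 · #interior points / 32 ≥ 7 (n − #rhombi near the boundary) / 96.

open import Defs hiding (_∈_; _∉_)
open import Data.Bool using (Bool; true; false; T; _∧_; _∨_)
open import Data.Empty using (⊥; ⊥-elim)
open import Data.Integer as ℤ using (ℤ; +_; -[1+_]; _⊖_; ∣_∣; _%ℕ_; _/ℕ_)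
open import Data.Integer.DivMod using (a≡a%ℕn+[a/ℕn]*n; n%ℕd<d)
import Data.Integer.Properties as ℤP
open import Algebra.Properties.AbelianGroup ℤP.+-0-abelianGroup
  using () renaming (∙-cancelˡ to +-cancelˡ; ∙-cancelʳ to +-cancelʳ)
import Data.Integer.Tactic.RingSolver as ℤSolver
open import Data.List using (List; []; _∷_; _++_; map; filter; length; concat; concatMap; upTo; head; drop)
import Data.List.Properties as LP
open import Data.List.Membership.Propositional using (_∈_; _∉_; find)
open import Data.List.Membership.Propositional.Properties
  using (∈-filter⁺; ∈-filter⁻; ∈-map⁺; ∈-map⁻; ∈-concatMap⁺; ∈-concatMap⁻; ∈-upTo⁺; ∈-upTo⁻)
open import Data.List.Relation.Binary.Permutation.Propositional using (↭-sym; ↭⇒↭ₛ)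
open import Data.List.Relation.Binary.Permutation.Propositional.Properties using (∈-resp-↭)
open import Data.List.Relation.Binary.Permutation.Setoid.Properties using (Unique-resp-↭)
open import Data.List.Relation.Binary.Sublist.Propositional.Properties using (filter-⊆; filter⁺; length-mono-≤)
open import Data.List.Relation.Unary.All as All using (All; _∷_; []; all?)
import Data.List.Relation.Unary.All.Properties as AllP
open import Data.List.Relation.Unary.Any as Any using (here; there)
open import Data.List.Relation.Unary.Unique.Propositional using (Unique; _∷_; [])
import Data.List.Relation.Unary.Unique.Propositional.Properties as Unique
open import Data.Maybe as Maybe using (just)
import Data.Maybe.Properties as MaybeP
open import Data.Nat as ℕ using (ℕ; zero; suc; _+_; _*_; _∸_; _≤_; _<_; _≥_; _≤ᵇ_; z≤n; s≤s; NonZero)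
open import Data.Nat.DivMod using (_%_; [m+kn]%n≡m%n; m<n⇒m%n≡m; n%n≡0)
open import Data.Nat.ListAction using (sum)
open import Data.Nat.ListAction.Properties using (sum-++)
import Data.Nat.Properties as ℕP
import Data.Nat.Tactic.RingSolver as ℕSolver
open import Data.Product using (_×_; _,_; proj₁; proj₂; ∃; ∃-syntax)
open import Data.Product.Properties using (≡-dec)
open import Data.Sum as Sum using (_⊎_; inj₁; inj₂)
open import Data.Unit using (tt)
open import Function using (_∘_)
open import Relation.Binary.Definitions using (DecidableEquality)
open import Relation.Binary.PropositionalEquality
open import Relation.Nullary using (¬_; Dec; does; yes; no; ¬?)
open import Relation.Nullary.Decidable using (toWitness; _×-dec_; _→-dec_)
open import Relation.Unary using (Decidable)

-- Counting in lists

boolToℕ : Bool → ℕ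
boolToℕ true = 1
boolToℕ false = 0

module _ {A : Set} where

  private
    remove : ∀ {x : A} ys → x ∈ ys → List A
    remove (_ ∷ ys) (here _) = ys
    remove (y ∷ ys) (there x∈ys) = y ∷ remove ys x∈ys

    length-remove : ∀ {x : A} ys (x∈ys : x ∈ ys) → length ys ≡ suc (length (remove ys x∈ys))
    length-remove (_ ∷ ys) (here _) = refl
    length-remove (_ ∷ ys) (there x∈ys) = cong suc (length-remove ys x∈ys)

    ∈-remove : ∀ {x z : A} ys (x∈ys : x ∈ ys) → z ∈ ys → z ≢ x → z ∈ remove ys x∈ys
    ∈-remove (_ ∷ ys) (here refl) (here refl) z≢x = ⊥-elim (z≢x refl)
    ∈-remove (_ ∷ ys) (here _) (there z∈ys) _ = z∈ys
    ∈-remove (_ ∷ ys) (there _) (here z≡y) _ = here z≡y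
    ∈-remove (_ ∷ ys) (there x∈ys) (there z∈ys) z≢x = there (∈-remove ys x∈ys z∈ys z≢x)

  Unique[xs]∧xs⊆ys⇒|xs|≤|ys| : ∀ {xs ys : List A} → Unique xs → (∀ {x} → x ∈ xs → x ∈ ys) →
                              length xs ≤ length ys
  Unique[xs]∧xs⊆ys⇒|xs|≤|ys| {[]} _ _ = z≤n
  Unique[xs]∧xs⊆ys⇒|xs|≤|ys| {x ∷ xs} {ys} u@(_ ∷ uxs) xs⊆ys =
    subst (suc (length xs) ≤_) (sym (length-remove ys x∈ys))
      (s≤s (Unique[xs]∧xs⊆ys⇒|xs|≤|ys| uxs λ z∈xs →
        ∈-remove ys x∈ys (xs⊆ys (there z∈xs))
          λ { refl → Unique.Unique[x∷xs]⇒x∉xs u z∈xs }))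
    where
    x∈ys : x ∈ ys
    x∈ys = xs⊆ys (here refl)

  module _ {B : Set} (g : A → List B) where

    unique-concatMap⁺ : ∀ {xs} → Unique xs → (∀ {x} → x ∈ xs → Unique (g x)) →
                        (∀ {x y z} → x ∈ xs → y ∈ xs → z ∈ g x → z ∈ g y → x ≡ y) →
                        Unique (concatMap g xs)
    unique-concatMap⁺ [] _ _ = []
    unique-concatMap⁺ {x ∷ xs} u@(_ ∷ uxs) ug shared =
      Unique.++⁺ (ug (here refl))
        (unique-concatMap⁺ uxs (λ y∈ → ug (there y∈)) (λ y∈ z∈ → shared (there y∈) (there z∈)))
        disjoint
      where
      disjoint : ∀ {z} → ¬ (z ∈ g x × z ∈ concatMap g xs)
      disjoint (z∈gx , z∈rest) with find (∈-concatMap⁻ g {xs = xs} z∈rest)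
      ... | y , y∈xs , z∈gy =
        Unique.Unique[x∷xs]⇒x∉xs u (subst (_∈ xs) (sym (shared (here refl) (there y∈xs) z∈gx z∈gy)) y∈xs)

    length-concatMap-≥ : ∀ k xs → (∀ {x} → x ∈ xs → k ≤ length (g x)) →
                         k * length xs ≤ length (concatMap g xs)
    length-concatMap-≥ k [] _ = ℕP.≤-reflexive (ℕP.*-zeroʳ k)
    length-concatMap-≥ k (x ∷ xs) k≤ = begin
      k * suc (length xs)                        ≡⟨ ℕP.*-suc k (length xs) ⟩
      k + k * length xs                          ≤⟨ ℕP.+-mono-≤ (k≤ (here refl))
                                                      (length-concatMap-≥ k xs (λ x∈ → k≤ (there x∈))) ⟩
      length (g x) + length (concatMap g xs)     ≡⟨ LP.length-++ (g x) ⟨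
      length (concatMap g (x ∷ xs))              ∎
      where open ℕP.≤-Reasoning

    length-concatMap-≤ : ∀ k xs → (∀ {x} → x ∈ xs → length (g x) ≤ k) →
                         length (concatMap g xs) ≤ k * length xs
    length-concatMap-≤ k [] _ = ℕP.≤-reflexive (sym (ℕP.*-zeroʳ k))
    length-concatMap-≤ k (x ∷ xs) ≤k = begin
      length (concatMap g (x ∷ xs))              ≡⟨ LP.length-++ (g x) ⟩
      length (g x) + length (concatMap g xs)     ≤⟨ ℕP.+-mono-≤ (≤k (here refl))
                                                      (length-concatMap-≤ k xs (λ x∈ → ≤k (there x∈))) ⟩
      k + k * length xs                          ≡⟨ ℕP.*-suc k (length xs) ⟨
      k * suc (length xs)                        ∎
      where open ℕP.≤-Reasoning

module _ {A : Set} {P : A → Set} (P? : Decidable P) where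

  length-filter≡sum : ∀ xs → length (filter P? xs) ≡ sum (map (boolToℕ ∘ does ∘ P?) xs)
  length-filter≡sum [] = refl
  length-filter≡sum (x ∷ xs) with does (P? x)
  ... | true = cong suc (length-filter≡sum xs)
  ... | false = length-filter≡sum xs

  length-filter-++ : ∀ xs ys → length (filter P? (xs ++ ys)) ≡ length (filter P? xs) + length (filter P? ys)
  length-filter-++ xs ys = trans (cong length (LP.filter-++ P? xs ys)) (LP.length-++ (filter P? xs))

  length≡length-filter-¬+length-filter : ∀ xs → length xs ≡ length (filter (¬? ∘ P?) xs) + length (filter P? xs)
  length≡length-filter-¬+length-filter [] = refl
  length≡length-filter-¬+length-filter (x ∷ xs) with P? x
  ... | yes _ = trans (cong suc (length≡length-filter-¬+length-filter xs)) (sym (ℕP.+-suc _ _))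
  ... | no _ = cong suc (length≡length-filter-¬+length-filter xs)

  length-filter-concatMap-≤ : ∀ {B : Set} {Q : B → Set} (Q? : Decidable Q) (g : B → List A) k →
    (∀ y → length (g y) ≤ k) → (∀ y → ¬ Q y → ∀ {x} → x ∈ g y → ¬ P x) →
    ∀ ys → length (filter P? (concatMap g ys)) ≤ k * length (filter Q? ys)
  length-filter-concatMap-≤ Q? g k |g|≤k ¬Q⇒¬P [] = ℕP.≤-reflexive (sym (ℕP.*-zeroʳ k))
  length-filter-concatMap-≤ Q? g k |g|≤k ¬Q⇒¬P (y ∷ ys) with Q? y
  ... | yes _ = begin
    length (filter P? (g y ++ concatMap g ys))              ≡⟨ length-filter-++ (g y) _ ⟩
    length (filter P? (g y)) + length (filter P? (concatMap g ys))
      ≤⟨ ℕP.+-mono-≤ (ℕP.≤-trans (LP.length-filter P? (g y)) (|g|≤k y)) rest ⟩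
    k + k * length (filter Q? ys)                            ≡⟨ ℕP.*-suc k _ ⟨
    k * suc (length (filter Q? ys))                          ∎
    where
    open ℕP.≤-Reasoning
    rest : length (filter P? (concatMap g ys)) ≤ k * length (filter Q? ys)
    rest = length-filter-concatMap-≤ Q? g k |g|≤k ¬Q⇒¬P ys
  ... | no ¬Qy = begin
    length (filter P? (g y ++ concatMap g ys))              ≡⟨ length-filter-++ (g y) _ ⟩
    length (filter P? (g y)) + length (filter P? (concatMap g ys))
      ≡⟨ cong (λ l → length l + _) (LP.filter-none P? (All.tabulate (¬Q⇒¬P y ¬Qy))) ⟩
    length (filter P? (concatMap g ys))                      ≤⟨ length-filter-concatMap-≤ Q? g k |g|≤k ¬Q⇒¬P ys ⟩
    k * length (filter Q? ys)                                ∎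
    where open ℕP.≤-Reasoning

-- Residues modulo d

-[1+m]%ℕd≡[d∸[1+m]%d]%d : ∀ d .{{_ : NonZero d}} m → -[1+ m ] %ℕ d ≡ (d ∸ suc m % d) % d
-[1+m]%ℕd≡[d∸[1+m]%d]%d (suc d) m with suc m % suc d
... | zero = sym (n%n≡0 (suc d))
... | suc x = sym (m<n⇒m%n≡m (s≤s (ℕP.m∸n≤m d x)))

[r+q*d]%ℕd≡r : ∀ d .{{_ : NonZero d}} {r} q → r < d → (+ r ℤ.+ q ℤ.* + d) %ℕ d ≡ r
[r+q*d]%ℕd≡r d {r} (+ n) r<d = begin
  (+ r ℤ.+ + n ℤ.* + d) %ℕ d   ≡⟨ cong (λ i → (+ r ℤ.+ i) %ℕ d) (ℤP.pos-* n d) ⟨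
  (r + n * d) % d             ≡⟨ [m+kn]%n≡m%n r n d ⟩
  r % d                       ≡⟨ m<n⇒m%n≡m r<d ⟩
  r                           ∎
  where open ≡-Reasoning
[r+q*d]%ℕd≡r (suc d) {r} -[1+ n ] (s≤s r≤d) = begin
  (r ⊖ (suc d + n * suc d)) %ℕ suc d                   ≡⟨ cong (_%ℕ suc d) negative ⟩
  -[1+ d ∸ r + n * suc d ] %ℕ suc d                    ≡⟨ -[1+m]%ℕd≡[d∸[1+m]%d]%d (suc d) _ ⟩
  (suc d ∸ (suc (d ∸ r) + n * suc d) % suc d) % suc d
    ≡⟨ cong (λ k → (suc d ∸ k) % suc d) ([m+kn]%n≡m%n (suc (d ∸ r)) n (suc d)) ⟩
  (suc d ∸ suc (d ∸ r) % suc d) % suc d                ≡⟨ complement r r≤d ⟩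
  r                                                   ∎
  where
  open ≡-Reasoning
  negative : r ⊖ (suc d + n * suc d) ≡ -[1+ d ∸ r + n * suc d ]
  negative = begin
    r ⊖ (suc d + n * suc d)
      ≡⟨ ℤP.⊖-< (s≤s (ℕP.≤-trans r≤d (ℕP.m≤m+n d (n * suc d)))) ⟩
    ℤ.- + ((suc d + n * suc d) ∸ r)
      ≡⟨ cong (λ k → ℤ.- + k) (ℕP.+-∸-comm (n * suc d) (ℕP.m≤n⇒m≤1+n r≤d)) ⟩
    ℤ.- + ((suc d ∸ r) + n * suc d)
      ≡⟨ cong (λ k → ℤ.- + (k + n * suc d)) (ℕP.+-∸-assoc 1 r≤d) ⟩
    -[1+ d ∸ r + n * suc d ]
      ∎
  complement : ∀ r → r ≤ d → (suc d ∸ suc (d ∸ r) % suc d) % suc d ≡ r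
  complement zero _ = begin
    (suc d ∸ suc d % suc d) % suc d      ≡⟨ cong (λ k → (suc d ∸ k) % suc d) (n%n≡0 (suc d)) ⟩
    suc d % suc d                        ≡⟨ n%n≡0 (suc d) ⟩
    0                                    ∎
  complement (suc r) r<d = begin
    (suc d ∸ suc (d ∸ suc r) % suc d) % suc d
      ≡⟨ cong (λ k → (suc d ∸ k) % suc d) (m<n⇒m%n≡m (s≤s (ℕP.∸-monoʳ-< (s≤s z≤n) r<d))) ⟩
    (d ∸ (d ∸ suc r)) % suc d                   ≡⟨ cong (_% suc d) (ℕP.m∸[m∸n]≡n r<d) ⟩
    suc r % suc d                               ≡⟨ m<n⇒m%n≡m (s≤s r<d) ⟩
    suc r                                       ∎

module _ (d : ℕ) .{{_ : NonZero d}} where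

  %ℕ-+ : ∀ a m → a %ℕ d + m < d → (a ℤ.+ + m) %ℕ d ≡ a %ℕ d + m
  %ℕ-+ a m lt = begin
    (a ℤ.+ + m) %ℕ d
      ≡⟨ cong (λ i → (i ℤ.+ + m) %ℕ d) (a≡a%ℕn+[a/ℕn]*n a d) ⟩
    (+ (a %ℕ d) ℤ.+ (a /ℕ d) ℤ.* + d ℤ.+ + m) %ℕ d
      ≡⟨ cong (_%ℕ d) (swap (+ (a %ℕ d)) ((a /ℕ d) ℤ.* + d) (+ m)) ⟩
    (+ (a %ℕ d + m) ℤ.+ (a /ℕ d) ℤ.* + d) %ℕ d
      ≡⟨ [r+q*d]%ℕd≡r d (a /ℕ d) lt ⟩
    a %ℕ d + m
      ∎
    where
    open ≡-Reasoning
    swap : ∀ x y z → x ℤ.+ y ℤ.+ z ≡ x ℤ.+ z ℤ.+ y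
    swap = ℤSolver.solve-∀

  roundDown : ℤ → ℤ
  roundDown a = (a /ℕ d) ℤ.* + d

  roundDown+%ℕ : ∀ a → roundDown a ℤ.+ + (a %ℕ d) ≡ a
  roundDown+%ℕ a = trans (ℤP.+-comm (roundDown a) _) (sym (a≡a%ℕn+[a/ℕn]*n a d))

  roundDown%ℕ≡0 : ∀ a → roundDown a %ℕ d ≡ 0
  roundDown%ℕ≡0 a = subst (λ i → i %ℕ d ≡ 0) (ℤP.+-identityˡ (roundDown a))
                      ([r+q*d]%ℕd≡r d (a /ℕ d) (ℕ.>-nonZero⁻¹ d))

  [a+m]%ℕd≡m : ∀ a m → a %ℕ d ≡ 0 → m < d → (a ℤ.+ + m) %ℕ d ≡ m
  [a+m]%ℕd≡m a m a%d≡0 m<d =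
    trans (%ℕ-+ a m (subst (λ r → r + m < d) (sym a%d≡0) m<d)) (cong (_+ m) a%d≡0)

  +-injective-%ℕ : ∀ {a b m n} → a %ℕ d ≡ 0 → b %ℕ d ≡ 0 → m < d → n < d →
                   a ℤ.+ + m ≡ b ℤ.+ + n → a ≡ b × m ≡ n
  +-injective-%ℕ {a} {b} {m} {n} a%d≡0 b%d≡0 m<d n<d eq =
    +-cancelʳ (+ m) a b (trans eq (cong (λ k → b ℤ.+ + k) (sym m≡n))) , m≡n
    where
    m≡n : m ≡ n
    m≡n = trans (sym ([a+m]%ℕd≡m a m a%d≡0 m<d)) (trans (cong (_%ℕ d) eq) ([a+m]%ℕd≡m b n b%d≡0 n<d))

-- Pairing strategies

makerPartAt : ℕ → List Pt → List Pt
makerPartAt zero = makerPart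
makerPartAt (suc _) = breakerPart

Partner-sym : ∀ {P u v} → Partner P u v → Partner P v u
Partner-sym (inj₁ uv∈P) = inj₂ uv∈P
Partner-sym (inj₂ vu∈P) = inj₁ vu∈P

head-∈-makerPart : ∀ {v} rest → head rest ≡ just v → v ∈ makerPart rest
head-∈-makerPart (_ ∷ _) refl = here refl

private
  unclaimed-∷ : ∀ {x : Pt} {rest c} → Unique (x ∷ rest) → (∀ {y} → y ∈ x ∷ rest → y ∉ c) →
                ∀ {y} → y ∈ rest → y ∉ x ∷ c
  unclaimed-∷ u _ y∈rest (here refl) = Unique.Unique[x∷xs]⇒x∉xs u y∈rest
  unclaimed-∷ _ fresh y∈rest (there y∈c) = fresh (there y∈rest) y∈c

pairing-claims-one-from : ∀ {P u v} c t rest → FollowsPairing P c t rest → Unique rest →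
                          (∀ {y} → y ∈ rest → y ∉ c) → Partner P u v → u ∈ rest → v ∈ rest →
                          u ∈ makerPartAt t rest ⊎ v ∈ makerPartAt t rest
pairing-claims-one-from c zero (x ∷ rest) _ _ _ _ (here refl) _ = inj₁ (here refl)
pairing-claims-one-from c zero (x ∷ rest) _ _ _ _ (there _) (here refl) = inj₂ (here refl)
pairing-claims-one-from c zero (x ∷ rest) follows u@(_ ∷ urest) fresh uv (there u∈) (there v∈) =
  Sum.map there there (pairing-claims-one-from (x ∷ c) 1 rest follows urest (unclaimed-∷ u fresh) uv u∈ v∈)
pairing-claims-one-from {v = v} c (suc _) (x ∷ rest) (answer , _) _ fresh uv (here refl) v∈ =
  inj₂ (head-∈-makerPart rest (answer v uv (fresh v∈)))
pairing-claims-one-from {u = u} c (suc _) (x ∷ rest) (answer , _) _ fresh uv (there u∈) (here refl) =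
  inj₁ (head-∈-makerPart rest (answer u (Partner-sym uv) (fresh (there u∈))))
pairing-claims-one-from c (suc _) (x ∷ rest) (_ , follows) u@(_ ∷ urest) fresh uv (there u∈) (there v∈) =
  pairing-claims-one-from (x ∷ c) 0 rest follows urest (unclaimed-∷ u fresh) uv u∈ v∈

pairing-claims-one : ∀ {V P play} → Unique V → PlayFollowing V P play →
                     ∀ {u v} → (u , v) ∈ P → u ∈ V → v ∈ V → u ∈ makerPart play ⊎ v ∈ makerPart play
pairing-claims-one uV (play↭V , follows) uv∈P u∈V v∈V =
  pairing-claims-one-from [] 0 _ follows (Unique-resp-↭ (setoid Pt) (↭⇒↭ₛ (↭-sym play↭V)) uV) (λ _ ())
    (inj₁ uv∈P) (∈-resp-↭ (↭-sym play↭V) u∈V) (∈-resp-↭ (↭-sym play↭V) v∈V)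

-- Blocks and the potential

-- Sums end in `+ 0`, the normal form of `sum (map f xs)` for an explicit list xs.
scores : Bool → Bool → Bool → Bool → ℕ
scores w x y z = boolToℕ (3 ≤ᵇ boolToℕ w + (boolToℕ x + (boolToℕ y + (boolToℕ z + 0))))

-- Maker's vertices in a 4 × 2 block of a cell: field a(2c + e) is column c, row e.
-- The pairing matches columns 0 ↔ 2 and 1 ↔ 3 within each row.
record Block : Set where
  constructor block
  field a0 a1 a2 a3 a4 a5 a6 a7 : Bool

Covered : Block → Set
Covered (block a0 a1 a2 a3 a4 a5 a6 a7) = T (a0 ∨ a4) × T (a1 ∨ a5) × T (a2 ∨ a6) × T (a3 ∨ a7)

innerScore : Block → ℕ
innerScore (block a0 a1 a2 a3 a4 a5 a6 a7) =
  scores a0 a2 a1 a3 + (scores a2 a4 a3 a1 + (scores a2 a4 a3 a5 + (scores a4 a6 a5 a3 + (scores a4 a6 a5 a7 + 0))))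

boundaryScore : Block → Block → ℕ
boundaryScore (block _ _ _ _ _ a5 a6 a7) (block b0 b1 b2 _ _ _ _ _) =
  scores a6 b0 a7 a5 + (scores a6 b0 a7 b1 + (scores b0 b2 b1 a7 + 0))

-- The credit a block passes on to its right neighbour; with it every further block pays for one
-- scoring rhombus (potential-step).
potential : Block → ℕ
potential (block true  true  false false false false true  true ) = 0
potential (block true  false true  false false true  false true ) = 0
potential (block false true  false false true  false true  true ) = 0
potential _ = 1

pairCases : (Bool → Bool → Bool) → Bool
pairCases f = f true false ∧ (f false true ∧ f true true)

pairCases-sound : ∀ f → T (pairCases f) → ∀ x y → T (x ∨ y) → T (f x y)
pairCases-sound f h true false _ with f true false
... | true = tt
pairCases-sound f h false true _ with f true false | f false true
... | true | true = tt
pairCases-sound f h true true _ with f true false | f false true | f true true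
... | true | true | true = tt

allCovered : (Block → Bool) → Bool
allCovered f = pairCases λ a0 a4 → pairCases λ a1 a5 → pairCases λ a2 a6 → pairCases λ a3 a7 →
               f (block a0 a1 a2 a3 a4 a5 a6 a7)

allCovered-sound : ∀ f → T (allCovered f) → ∀ u → Covered u → T (f u)
allCovered-sound f h (block a0 a1 a2 a3 a4 a5 a6 a7) (c0 , c1 , c2 , c3) =
  pairCases-sound f₃
    (pairCases-sound f₂ (pairCases-sound f₁ (pairCases-sound f₀ h a0 a4 c0) a1 a5 c1) a2 a6 c2) a3 a7 c3
  where
  f₀ f₁ f₂ f₃ : Bool → Bool → Bool
  f₀ a0 a4 = pairCases λ a1 a5 → pairCases λ a2 a6 → pairCases λ a3 a7 → f (block a0 a1 a2 a3 a4 a5 a6 a7)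
  f₁ a1 a5 = pairCases λ a2 a6 → pairCases λ a3 a7 → f (block a0 a1 a2 a3 a4 a5 a6 a7)
  f₂ a2 a6 = pairCases λ a3 a7 → f (block a0 a1 a2 a3 a4 a5 a6 a7)
  f₃ a3 a7 = f (block a0 a1 a2 a3 a4 a5 a6 a7)

potential-start : ∀ u → Covered u → potential u ≤ innerScore u
potential-start u cu = ℕP.≤ᵇ⇒≤ _ _ (allCovered-sound (λ u → potential u ≤ᵇ innerScore u) tt u cu)

potential-step : ∀ u v → Covered u → Covered v →
                 1 + potential v ≤ potential u + (boundaryScore u v + innerScore v)
potential-step u v cu cv =
  ℕP.≤ᵇ⇒≤ _ _ (allCovered-sound (step u) (allCovered-sound (λ u → allCovered (step u)) tt u cu) v cv)
  where
  step : Block → Block → Bool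
  step u v = (1 + potential v) ≤ᵇ (potential u + (boundaryScore u v + innerScore v))

telescope : ∀ pu {pv k} y r → 1 + pv ≤ pu + y → k ≤ pv + r → 1 + k ≤ pu + (y + r)
telescope pu {pv} {k} y r step rest = ℕP.+-cancelʳ-≤ pv (1 + k) (pu + (y + r)) (begin
  1 + k + pv           ≡⟨ shuffle₁ k pv ⟩
  (1 + pv) + k         ≤⟨ ℕP.+-mono-≤ step rest ⟩
  (pu + y) + (pv + r)  ≡⟨ shuffle₂ pu y pv r ⟩
  pu + (y + r) + pv    ∎)
  where
  open ℕP.≤-Reasoning
  shuffle₁ : ∀ a b → 1 + a + b ≡ (1 + b) + a
  shuffle₁ = ℕSolver.solve-∀
  shuffle₂ : ∀ a b c d → (a + b) + (c + d) ≡ a + (b + d) + c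
  shuffle₂ = ℕSolver.solve-∀

rowScore : (ℕ → Block) → ℕ → ℕ → ℕ
rowScore u i zero = 0
rowScore u i (suc n) = (boundaryScore (u i) (u (suc i)) + innerScore (u (suc i))) + rowScore u (suc i) n

potential-row : ∀ u n i → (∀ j → j ≤ i + n → Covered (u j)) → n ≤ potential (u i) + rowScore u i n
potential-row u zero i _ = z≤n
potential-row u (suc n) i covered =
  telescope (potential (u i)) (boundaryScore (u i) (u (suc i)) + innerScore (u (suc i)))
    (rowScore u (suc i) n)
    (potential-step (u i) (u (suc i)) (covered i (ℕP.m≤m+n i (suc n))) (covered (suc i) suc-i≤))
    (potential-row u n (suc i) λ j j≤ → covered j (ℕP.≤-trans j≤ (ℕP.≤-reflexive (sym (ℕP.+-suc i n)))))
  where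
  suc-i≤ : suc i ≤ i + suc n
  suc-i≤ = subst (suc i ≤_) (sym (ℕP.+-suc i n)) (s≤s (ℕP.m≤m+n i n))

row-score : ∀ u n → (∀ j → j ≤ n → Covered (u j)) → n ≤ innerScore (u 0) + rowScore u 0 n
row-score u n covered =
  ℕP.≤-trans (potential-row u n 0 covered) (ℕP.+-monoˡ-≤ _ (potential-start (u 0) (covered 0 z≤n)))

-- Cells

offset : Pt → ℕ → ℕ → Pt
offset q k e = shift q (+ k) (+ e)

shift-offset : ∀ q k e x y → shift (offset q k e) (+ x) (+ y) ≡ offset q (x + k) (y + e)
shift-offset (a , b) k e x y = cong₂ _,_ (reassoc a k x) (reassoc b e y)
  where
  reassoc : ∀ a k x → a ℤ.+ + k ℤ.+ + x ≡ a ℤ.+ + (x + k)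
  reassoc a k x = trans (ℤP.+-assoc a (+ k) (+ x)) (cong (λ n → a ℤ.+ + n) (ℕP.+-comm k x))

shift-offset-back : ∀ q k e y → shift (offset q (suc k) e) (ℤ.- + 1) (+ y) ≡ offset q k (y + e)
shift-offset-back (a , b) k e y =
  cong₂ _,_ (ℤP.+-assoc a (+ suc k) -[1+ 0 ])
            (trans (ℤP.+-assoc b (+ e) (+ y)) (cong (λ n → b ℤ.+ + n) (ℕP.+-comm e y)))

rhombus-o₁ : ∀ q k → rhombus (offset q k 0) o₁ ≡
             offset q k 0 ∷ offset q (suc k) 0 ∷ offset q k 1 ∷ offset q (suc k) 1 ∷ []
rhombus-o₁ q k = cong₂ (λ x rest → offset q k 0 ∷ x ∷ rest) (shift-offset q k 0 1 0)
                   (cong₂ (λ y z → y ∷ z ∷ []) (shift-offset q k 0 0 1) (shift-offset q k 0 1 1))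

rhombus-o₃ : ∀ q k → rhombus (offset q (suc k) 0) o₃ ≡
             offset q (suc k) 0 ∷ offset q (2 + k) 0 ∷ offset q (suc k) 1 ∷ offset q k 1 ∷ []
rhombus-o₃ q k = cong₂ (λ x rest → offset q (suc k) 0 ∷ x ∷ rest) (shift-offset q (suc k) 0 1 0)
                   (cong₂ (λ y z → y ∷ z ∷ []) (shift-offset q (suc k) 0 0 1) (shift-offset-back q k 0 1))

rhombus-head : ∀ p o → head (rhombus p o) ≡ just p
rhombus-head p o₁ = refl
rhombus-head p o₂ = refl
rhombus-head p o₃ = refl

rhombus-injective : ∀ {p o q r} → rhombus p o ≡ rhombus q r → p ≡ q × o ≡ r
rhombus-injective {p} {o} {q} {r} eq with
  MaybeP.just-injective (trans (sym (rhombus-head p o)) (trans (cong head eq) (rhombus-head q r)))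
... | refl = refl , same-orientation o r eq
  where
  fourth : (Pt → ℤ) → List Pt → Maybe.Maybe ℤ
  fourth f = Maybe.map f ∘ head ∘ drop 3
  1≢-1 : ∀ a → a ℤ.+ + 1 ≢ a ℤ.+ -[1+ 0 ]
  1≢-1 a eq with +-cancelˡ a (+ 1) -[1+ 0 ] eq
  ... | ()
  same-orientation : ∀ o r → rhombus p o ≡ rhombus p r → o ≡ r
  same-orientation o₁ o₁ _ = refl
  same-orientation o₂ o₂ _ = refl
  same-orientation o₃ o₃ _ = refl
  same-orientation o₁ o₂ eq = ⊥-elim (1≢-1 (proj₂ p) (MaybeP.just-injective (cong (fourth proj₂) eq)))
  same-orientation o₂ o₁ eq = ⊥-elim (1≢-1 (proj₂ p) (MaybeP.just-injective (cong (fourth proj₂) (sym eq))))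
  same-orientation o₁ o₃ eq = ⊥-elim (1≢-1 (proj₁ p) (MaybeP.just-injective (cong (fourth proj₁) eq)))
  same-orientation o₃ o₁ eq = ⊥-elim (1≢-1 (proj₁ p) (MaybeP.just-injective (cong (fourth proj₁) (sym eq))))
  same-orientation o₂ o₃ eq = ⊥-elim (1≢-1 (proj₁ p) (MaybeP.just-injective (cong (fourth proj₁) eq)))
  same-orientation o₃ o₂ eq = ⊥-elim (1≢-1 (proj₁ p) (MaybeP.just-injective (cong (fourth proj₁) (sym eq))))

bit : List Pt → Pt → Bool
bit M x = does (x ∈? M)

scores? : (M r : List Pt) → Dec (3 ≤ claimedIn M r)
scores? M r = 3 ℕ.≤? claimedIn M r

scoring : List Pt → List (List Pt) → List (List Pt)
scoring M = filter (scores? M)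

scoreOf : List Pt → List Pt → ℕ
scoreOf M = boolToℕ ∘ does ∘ scores? M

scoreOf-rhombus : ∀ M w x y z →
                  scoreOf M (w ∷ x ∷ y ∷ z ∷ []) ≡ scores (bit M w) (bit M x) (bit M y) (bit M z)
scoreOf-rhombus M w x y z =
  cong (λ n → boolToℕ (3 ℕ.≤ᵇ n)) (length-filter≡sum (_∈? M) (w ∷ x ∷ y ∷ z ∷ []))

Anchor : Set
Anchor = ℕ × Orientation

cellRhombus : Pt → Anchor → List Pt
cellRhombus q (k , o) = rhombus (offset q k 0) o

scoreOf-o₁ : ∀ M q k → scoreOf M (cellRhombus q (k , o₁)) ≡
             scores (bit M (offset q k 0)) (bit M (offset q (suc k) 0)) (bit M (offset q k 1)) (bit M (offset q (suc k) 1))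
scoreOf-o₁ M q k = trans (cong (scoreOf M) (rhombus-o₁ q k)) (scoreOf-rhombus M _ _ _ _)

scoreOf-o₃ : ∀ M q k → scoreOf M (cellRhombus q (suc k , o₃)) ≡
             scores (bit M (offset q (suc k) 0)) (bit M (offset q (2 + k) 0)) (bit M (offset q (suc k) 1)) (bit M (offset q k 1))
scoreOf-o₃ M q k = trans (cong (scoreOf M) (rhombus-o₃ q k)) (scoreOf-rhombus M _ _ _ _)

blockAt : List Pt → Pt → ℕ → Block
blockAt M q i = block (b (i * 4) 0) (b (i * 4) 1) (b (1 + i * 4) 0) (b (1 + i * 4) 1)
                      (b (2 + i * 4) 0) (b (2 + i * 4) 1) (b (3 + i * 4) 0) (b (3 + i * 4) 1)
  where
  b : ℕ → ℕ → Bool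
  b k e = bit M (offset q k e)

blockAnchors : ℕ → List Anchor
blockAnchors i = (i * 4 , o₁) ∷ (1 + i * 4 , o₃) ∷ (1 + i * 4 , o₁) ∷ (2 + i * 4 , o₃) ∷ (2 + i * 4 , o₁) ∷ []

boundaryAnchors : ℕ → List Anchor
boundaryAnchors i = (3 + i * 4 , o₃) ∷ (3 + i * 4 , o₁) ∷ (4 + i * 4 , o₃) ∷ []

rowAnchors : ℕ → ℕ → List Anchor
rowAnchors i zero = []
rowAnchors i (suc n) = boundaryAnchors i ++ (blockAnchors (suc i) ++ rowAnchors (suc i) n)

cellAnchors : List Anchor
cellAnchors = blockAnchors 0 ++ rowAnchors 0 7

scoringIn : List Pt → Pt → List (List Pt)
scoringIn M q = scoring M (map (cellRhombus q) cellAnchors)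

module _ (M : List Pt) (q : Pt) where

  anchorScore : List Anchor → ℕ
  anchorScore = sum ∘ map (scoreOf M ∘ cellRhombus q)

  anchorScore-++ : ∀ xs ys → anchorScore (xs ++ ys) ≡ anchorScore xs + anchorScore ys
  anchorScore-++ xs ys =
    trans (cong sum (LP.map-++ (scoreOf M ∘ cellRhombus q) xs ys)) (sum-++ (map (scoreOf M ∘ cellRhombus q) xs) _)

  anchorScore-block : ∀ i → anchorScore (blockAnchors i) ≡ innerScore (blockAt M q i)
  anchorScore-block i =
    cong₂ _+_ (scoreOf-o₁ M q (i * 4)) (cong₂ _+_ (scoreOf-o₃ M q (i * 4))
      (cong₂ _+_ (scoreOf-o₁ M q (1 + i * 4)) (cong₂ _+_ (scoreOf-o₃ M q (1 + i * 4))
        (cong₂ _+_ (scoreOf-o₁ M q (2 + i * 4)) refl))))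

  anchorScore-boundary : ∀ i → anchorScore (boundaryAnchors i) ≡ boundaryScore (blockAt M q i) (blockAt M q (suc i))
  anchorScore-boundary i =
    cong₂ _+_ (scoreOf-o₃ M q (2 + i * 4)) (cong₂ _+_ (scoreOf-o₁ M q (3 + i * 4))
      (cong₂ _+_ (scoreOf-o₃ M q (3 + i * 4)) refl))

  anchorScore-row : ∀ i n → anchorScore (rowAnchors i n) ≡ rowScore (blockAt M q) i n
  anchorScore-row i zero = refl
  anchorScore-row i (suc n) = begin
    anchorScore (boundaryAnchors i ++ (blockAnchors (suc i) ++ rowAnchors (suc i) n))
      ≡⟨ anchorScore-++ (boundaryAnchors i) (blockAnchors (suc i) ++ rowAnchors (suc i) n) ⟩
    anchorScore (boundaryAnchors i) + anchorScore (blockAnchors (suc i) ++ rowAnchors (suc i) n)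
      ≡⟨ cong (λ n → anchorScore (boundaryAnchors i) + n) (anchorScore-++ (blockAnchors (suc i)) (rowAnchors (suc i) n)) ⟩
    anchorScore (boundaryAnchors i) + (anchorScore (blockAnchors (suc i)) + anchorScore (rowAnchors (suc i) n))
      ≡⟨ ℕP.+-assoc (anchorScore (boundaryAnchors i)) (anchorScore (blockAnchors (suc i)))
                    (anchorScore (rowAnchors (suc i) n)) ⟨
    anchorScore (boundaryAnchors i) + anchorScore (blockAnchors (suc i)) + anchorScore (rowAnchors (suc i) n)
      ≡⟨ cong₂ _+_ (cong₂ _+_ (anchorScore-boundary i) (anchorScore-block (suc i))) (anchorScore-row (suc i) n) ⟩
    rowScore (blockAt M q) i (suc n) ∎
    where open ≡-Reasoning

  length-scoringIn : length (scoringIn M q) ≡ innerScore (blockAt M q 0) + rowScore (blockAt M q) 0 7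
  length-scoringIn = begin
    length (scoringIn M q)
      ≡⟨ length-filter≡sum (scores? M) (map (cellRhombus q) cellAnchors) ⟩
    sum (map (scoreOf M) (map (cellRhombus q) cellAnchors))
      ≡⟨ cong sum (LP.map-∘ {g = scoreOf M} {f = cellRhombus q} cellAnchors) ⟨
    anchorScore cellAnchors
      ≡⟨ anchorScore-++ (blockAnchors 0) (rowAnchors 0 7) ⟩
    anchorScore (blockAnchors 0) + anchorScore (rowAnchors 0 7)
      ≡⟨ cong₂ _+_ (anchorScore-block 0) (anchorScore-row 0 7) ⟩
    innerScore (blockAt M q 0) + rowScore (blockAt M q) 0 7 ∎
    where open ≡-Reasoning

0<2 : 0 < 2
0<2 = s≤s z≤n

1<2 : 1 < 2
1<2 = s≤s (s≤s z≤n)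

cellPoints : Pt → List Pt
cellPoints q = concatMap (λ k → offset q k 0 ∷ offset q k 1 ∷ []) (upTo 32)

offset-∈-cellPoints : ∀ q {k e} → k < 32 → e < 2 → offset q k e ∈ cellPoints q
offset-∈-cellPoints q {k} {e} k<32 e<2 =
  ∈-concatMap⁺ (λ k → offset q k 0 ∷ offset q k 1 ∷ []) (Any.map (∈-pair e e<2) (∈-upTo⁺ k<32))
  where
  ∈-pair : ∀ e → e < 2 → ∀ {j} → k ≡ j → offset q k e ∈ offset q j 0 ∷ offset q j 1 ∷ []
  ∈-pair zero _ refl = here refl
  ∈-pair (suc zero) _ refl = there (here refl)
  ∈-pair (suc (suc _)) (s≤s (s≤s ())) _

∈-cellPoints⁻ : ∀ q {z} → z ∈ cellPoints q → ∃[ k ] ∃[ e ] k < 32 × e < 2 × z ≡ offset q k e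
∈-cellPoints⁻ q z∈ with find (∈-concatMap⁻ (λ k → offset q k 0 ∷ offset q k 1 ∷ []) {xs = upTo 32} z∈)
... | k , k∈ , here z≡ = k , 0 , ∈-upTo⁻ k∈ , 0<2 , z≡
... | k , k∈ , there (here z≡) = k , 1 , ∈-upTo⁻ k∈ , 1<2 , z≡

CellIn : List Pt → Pt → Set
CellIn V q = All (_∈ V) (cellPoints q)

offset-∈ : ∀ {V} q {k e} → CellIn V q → k < 32 → e < 2 → offset q k e ∈ V
offset-∈ q inV k<32 e<2 = All.lookup inV (offset-∈-cellPoints q k<32 e<2)

FitsInCell : Anchor → Set
FitsInCell (k , o₁) = k < 31
FitsInCell (_ , o₂) = ⊥
FitsInCell (zero , o₃) = ⊥
FitsInCell (suc k , o₃) = suc k < 31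

fitsInCell? : Decidable FitsInCell
fitsInCell? (k , o₁) = k ℕ.<? 31
fitsInCell? (_ , o₂) = no λ ()
fitsInCell? (zero , o₃) = no λ ()
fitsInCell? (suc k , o₃) = suc k ℕ.<? 31

cellAnchors-fit : All FitsInCell cellAnchors
cellAnchors-fit = toWitness {a? = all? fitsInCell? cellAnchors} tt

fits⇒<32 : ∀ {k o} → FitsInCell (k , o) → k < 32
fits⇒<32 {k} {o₁} k<31 = ℕP.m≤n⇒m≤1+n k<31
fits⇒<32 {suc k} {o₃} k<31 = ℕP.m≤n⇒m≤1+n k<31

cellRhombus-⊆ : ∀ {V q x} → CellIn V q → FitsInCell x → All (_∈ V) (cellRhombus q x)
cellRhombus-⊆ {V} {q} {k , o₁} inV k<31 = subst (All (_∈ V)) (sym (rhombus-o₁ q k))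
  (offset-∈ q inV k<32 0<2 ∷ offset-∈ q inV (s≤s k<31) 0<2 ∷
   offset-∈ q inV k<32 1<2 ∷ offset-∈ q inV (s≤s k<31) 1<2 ∷ [])
  where
  k<32 : k < 32
  k<32 = ℕP.m≤n⇒m≤1+n k<31
cellRhombus-⊆ {V} {q} {suc k , o₃} inV k<31 = subst (All (_∈ V)) (sym (rhombus-o₃ q k))
  (offset-∈ q inV k<32 0<2 ∷ offset-∈ q inV (s≤s k<31) 0<2 ∷
   offset-∈ q inV k<32 1<2 ∷ offset-∈ q inV k-1<32 1<2 ∷ [])
  where
  k<32 : suc k < 32
  k<32 = ℕP.m≤n⇒m≤1+n k<31
  k-1<32 : k < 32
  k-1<32 = ℕP.<-trans (ℕP.n<1+n k) k<32

_≟ₒ_ : DecidableEquality Orientation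
o₁ ≟ₒ o₁ = yes refl
o₂ ≟ₒ o₂ = yes refl
o₃ ≟ₒ o₃ = yes refl
o₁ ≟ₒ o₂ = no λ ()
o₁ ≟ₒ o₃ = no λ ()
o₂ ≟ₒ o₁ = no λ ()
o₂ ≟ₒ o₃ = no λ ()
o₃ ≟ₒ o₁ = no λ ()
o₃ ≟ₒ o₂ = no λ ()

unique-cellAnchors : Unique cellAnchors
unique-cellAnchors = toWitness {a? = unique? cellAnchors} tt
  where open import Data.List.Relation.Unary.Unique.DecPropositional (≡-dec ℕ._≟_ _≟ₒ_) using (unique?)

cellRhombus-injective : ∀ q {x y} → cellRhombus q x ≡ cellRhombus q y → x ≡ y
cellRhombus-injective (a , _) {k , o} {j , _} eq with rhombus-injective eq
... | offset≡ , refl = cong (_, o) (ℤP.+-injective (+-cancelˡ a (+ k) (+ j) (cong proj₁ offset≡)))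

IsBase : Pt → Set
IsBase q = proj₁ q %ℕ 32 ≡ 0

cellRhombus-base-injective : ∀ {q r x y} → IsBase q → IsBase r → FitsInCell x → FitsInCell y →
                             cellRhombus q x ≡ cellRhombus r y → q ≡ r
cellRhombus-base-injective {a , b} {c , d} {k , o} {j , p} q-base r-base x-fits y-fits eq
  with rhombus-injective eq
... | offset≡ , _ =
  cong₂ _,_ (proj₁ (+-injective-%ℕ 32 q-base r-base (fits⇒<32 x-fits) (fits⇒<32 y-fits) (cong proj₁ offset≡)))
            (trans (sym (ℤP.+-identityʳ b)) (trans (cong proj₂ offset≡) (ℤP.+-identityʳ d)))

-- The pairing

column : Pt → ℕ
column p = proj₁ p %ℕ 32

Left : ℕ → Set
Left r = r % 4 < 2

left? : Decidable Left
left? r = r % 4 ℕ.<? 2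

partner : Pt → Pt
partner p = shift p (+ 2) (+ 0)

partner-injective : ∀ {p q} → partner p ≡ partner q → p ≡ q
partner-injective {a , b} {c , d} eq =
  cong₂ _,_ (+-cancelʳ (+ 2) a c (cong proj₁ eq)) (+-cancelʳ (+ 0) b d (cong proj₂ eq))

Left⇒[r+2]<32∧¬Left[r+2] : ∀ r → r < 32 → Left r → r + 2 < 32 × ¬ Left (r + 2)
Left⇒[r+2]<32∧¬Left[r+2] r r<32 = All.lookup (toWitness {a? = all? check (upTo 32)} tt) (∈-upTo⁺ r<32)
  where
  check : Decidable (λ r → Left r → r + 2 < 32 × ¬ Left (r + 2))
  check r = left? r →-dec ((r + 2 ℕ.<? 32) ×-dec ¬? (left? (r + 2)))

partner-not-left : ∀ p → Left (column p) → ¬ Left (column (partner p))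
partner-not-left p left-p = subst (¬_ ∘ Left) (sym column-partner) (proj₂ shifted)
  where
  shifted : column p + 2 < 32 × ¬ Left (column p + 2)
  shifted = Left⇒[r+2]<32∧¬Left[r+2] (column p) (n%ℕd<d (proj₁ p) 32) left-p
  column-partner : column (partner p) ≡ column p + 2
  column-partner = %ℕ-+ 32 (proj₁ p) 2 (proj₁ shifted)

Paired : List Pt → Pt → Set
Paired V p = Left (column p) × partner p ∈ V

paired? : (V : List Pt) → Decidable (Paired V)
paired? V p = left? (column p) ×-dec (partner p ∈? V)

pairing : List Pt → Pairing
pairing V = map (λ p → p , partner p) (filter (paired? V) V)

pairing-valid : ∀ V → Unique V → ValidPairing V (pairing V)
pairing-valid V uV =
  AllP.map⁺ (All.tabulate in-V) , subst Unique (cong concat (LP.map-∘ leftmost)) unique-vertices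
  where
  leftmost : List Pt
  leftmost = filter (paired? V) V
  in-V : ∀ {p} → p ∈ leftmost → p ∈ V × partner p ∈ V
  in-V p∈ = let p∈V , _ , partner∈V = ∈-filter⁻ (paired? V) {xs = V} p∈ in p∈V , partner∈V
  left : ∀ {p} → p ∈ leftmost → Left (column p)
  left p∈ = proj₁ (proj₂ (∈-filter⁻ (paired? V) {xs = V} p∈))
  not-self : ∀ {p} → p ∈ leftmost → Unique (p ∷ partner p ∷ [])
  not-self {p} p∈ = ((λ p≡ → partner-not-left p (left p∈) (subst (Left ∘ column) p≡ (left p∈))) ∷ []) ∷ [] ∷ []
  shared : ∀ {p q z} → p ∈ leftmost → q ∈ leftmost →
           z ∈ p ∷ partner p ∷ [] → z ∈ q ∷ partner q ∷ [] → p ≡ q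
  shared _ _ (here refl) (here refl) = refl
  shared {q = q} p∈ q∈ (here refl) (there (here p≡pq)) =
    ⊥-elim (partner-not-left q (left q∈) (subst (Left ∘ column) p≡pq (left p∈)))
  shared {p} p∈ q∈ (there (here refl)) (here pp≡q) =
    ⊥-elim (partner-not-left p (left p∈) (subst (Left ∘ column) (sym pp≡q) (left q∈)))
  shared _ _ (there (here refl)) (there (here pp≡pq)) = partner-injective pp≡pq
  unique-vertices : Unique (concatMap (λ p → p ∷ partner p ∷ []) leftmost)
  unique-vertices = unique-concatMap⁺ _ (Unique.filter⁺ (paired? V) uV) not-self shared

MakerCovers : List Pt → List Pt → Set
MakerCovers V M = ∀ {x} → x ∈ V → Left (column x) → partner x ∈ V → x ∈ M ⊎ partner x ∈ M

pairing-covers : ∀ {V play} → Unique V → PlayFollowing V (pairing V) play → MakerCovers V (makerPart play)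
pairing-covers {V} uV follows x∈V left-x partner∈V =
  pairing-claims-one uV follows (∈-map⁺ (λ p → p , partner p) (∈-filter⁺ (paired? V) x∈V (left-x , partner∈V)))
    x∈V partner∈V

-- Every cell scores seven

bit-∨ : ∀ {M x y} → x ∈ M ⊎ y ∈ M → T (bit M x ∨ bit M y)
bit-∨ {M} {x} (inj₁ x∈M) with x ∈? M
... | yes _ = tt
... | no x∉M = ⊥-elim (x∉M x∈M)
bit-∨ {M} {x} {y} (inj₂ y∈M) with x ∈? M | y ∈? M
... | yes _ | _ = tt
... | no _ | yes _ = tt
... | no _ | no y∉M = ⊥-elim (y∉M y∈M)

module _ {V M q} (q-base : IsBase q) (inV : CellIn V q) (covers : MakerCovers V M) where

  pair-covered : ∀ {m j e} → m < 2 → j ≤ 7 → e < 2 →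
                 T (bit M (offset q (m + j * 4) e) ∨ bit M (offset q (2 + (m + j * 4)) e))
  pair-covered {m} {j} {e} m<2 j≤7 e<2 =
    bit-∨ (subst (λ p → offset q k e ∈ M ⊎ p ∈ M) (shift-offset q k e 2 0)
      (covers (offset-∈ q inV k<32 e<2) left-k
        (subst (_∈ V) (sym (shift-offset q k e 2 0)) (offset-∈ q inV k+2<32 e<2))))
    where
    k : ℕ
    k = m + j * 4
    k+2<32 : 2 + k < 32
    k+2<32 = s≤s (s≤s (s≤s (ℕP.+-mono-≤ {m} {1} {j * 4} {28} (ℕP.<⇒≤pred m<2) (ℕP.*-monoˡ-≤ 4 j≤7))))
    k<32 : k < 32
    k<32 = ℕP.<-trans (ℕP.n<1+n k) (ℕP.<-trans (ℕP.n<1+n (suc k)) k+2<32)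
    left-k : Left (column (offset q k e))
    left-k = subst Left (sym ([a+m]%ℕd≡m 32 (proj₁ q) k q-base k<32)) (subst (_< 2) (sym k%4≡m) m<2)
      where
      k%4≡m : k % 4 ≡ m
      k%4≡m = trans ([m+kn]%n≡m%n m j 4) (m<n⇒m%n≡m (ℕP.≤-trans m<2 (s≤s (s≤s z≤n))))

  blocks-covered : ∀ j → j ≤ 7 → Covered (blockAt M q j)
  blocks-covered j j≤7 =
    pair-covered 0<2 j≤7 0<2 , pair-covered 0<2 j≤7 1<2 , pair-covered 1<2 j≤7 0<2 , pair-covered 1<2 j≤7 1<2

  cell-score : 7 ≤ length (scoringIn M q)
  cell-score = subst (7 ≤_) (sym (length-scoringIn M q)) (row-score (blockAt M q) 7 blocks-covered)

rhombus-∈-winningSets : ∀ {V p} o → p ∈ V → All (_∈ V) (rhombus p o) → rhombus p o ∈ winningSets V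
rhombus-∈-winningSets {V} {p} o p∈V inV =
  ∈-filter⁺ (λ r → all? (_∈? V) r)
    (∈-concatMap⁺ (λ p → map (rhombus p) orientations) (Any.map (λ { refl → ∈-map⁺ (rhombus p) (o∈ o) }) p∈V))
    inV
  where
  o∈ : ∀ o → o ∈ orientations
  o∈ o₁ = here refl
  o∈ o₂ = there (here refl)
  o∈ o₃ = there (there (here refl))

Cell : List Pt → Pt → Set
Cell V q = IsBase q × CellIn V q

cell? : (V : List Pt) → Decidable (Cell V)
cell? V q = (proj₁ q %ℕ 32 ℕ.≟ 0) ×-dec all? (_∈? V) (cellPoints q)

cells : List Pt → List Pt
cells V = filter (cell? V) V

∈-cells⁻ : ∀ V {q} → q ∈ cells V → Cell V q
∈-cells⁻ V q∈ = proj₂ (∈-filter⁻ (cell? V) {xs = V} q∈)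

∈-scoringIn⁻ : ∀ {M q r} → r ∈ scoringIn M q →
               ∃ λ x → x ∈ cellAnchors × r ≡ cellRhombus q x × 3 ≤ claimedIn M r
∈-scoringIn⁻ {M} {q} r∈ =
  let r∈cell , scores-r = ∈-filter⁻ (scores? M) {xs = map (cellRhombus q) cellAnchors} r∈
      x , x∈ , r≡ = ∈-map⁻ (cellRhombus q) {xs = cellAnchors} r∈cell
  in x , x∈ , r≡ , scores-r

cellRhombus-∈-winningSets : ∀ {V q x} → Cell V q → FitsInCell x → cellRhombus q x ∈ winningSets V
cellRhombus-∈-winningSets {V} {q} {k , o} (_ , inV) fits =
  rhombus-∈-winningSets o (offset-∈ q inV (fits⇒<32 fits) 0<2) (cellRhombus-⊆ {V} {q} {k , o} inV fits)

cellScoring : List Pt → List Pt → List (List Pt)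
cellScoring V M = concatMap (scoringIn M) (cells V)

unique-cellScoring : ∀ {V} M → Unique V → Unique (cellScoring V M)
unique-cellScoring {V} M uV = unique-concatMap⁺ (scoringIn M) (Unique.filter⁺ (cell? V) uV)
  (λ {q} _ → Unique.filter⁺ (scores? M) (Unique.map⁺ (cellRhombus-injective q) unique-cellAnchors)) shared
  where
  shared : ∀ {q r z} → q ∈ cells V → r ∈ cells V → z ∈ scoringIn M q → z ∈ scoringIn M r → q ≡ r
  shared {q} {r} q∈ r∈ z∈q z∈r =
    let x , x∈ , z≡x , _ = ∈-scoringIn⁻ {M} {q} z∈q
        y , y∈ , z≡y , _ = ∈-scoringIn⁻ {M} {r} z∈r
    in cellRhombus-base-injective (proj₁ (∈-cells⁻ V q∈)) (proj₁ (∈-cells⁻ V r∈))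
         (All.lookup cellAnchors-fit x∈) (All.lookup cellAnchors-fit y∈) (trans (sym z≡x) z≡y)

cellScoring-⊆ : ∀ {V M r} → r ∈ cellScoring V M → r ∈ scoring M (winningSets V)
cellScoring-⊆ {V} {M} r∈ =
  let q , q∈ , r∈q = find (∈-concatMap⁻ (scoringIn M) {xs = cells V} r∈)
      x , x∈ , r≡ , scores-r = ∈-scoringIn⁻ {M} {q} r∈q
  in ∈-filter⁺ (scores? M)
       (subst (_∈ winningSets V) (sym r≡)
         (cellRhombus-∈-winningSets {V} {q} {x} (∈-cells⁻ V q∈) (All.lookup cellAnchors-fit x∈)))
       scores-r

pairing-score : ∀ V → Unique V → PairingGuarantees 3 V (pairing V) (7 * length (cells V))
pairing-score V uV play follows = begin
  7 * length (cells V)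
    ≤⟨ length-concatMap-≥ (scoringIn M) 7 (cells V) cell-scores ⟩
  length (cellScoring V M)
    ≤⟨ Unique[xs]∧xs⊆ys⇒|xs|≤|ys| (unique-cellScoring M uV) (cellScoring-⊆ {V} {M}) ⟩
  length (scoring M (winningSets V))
    ∎
  where
  open ℕP.≤-Reasoning
  M : List Pt
  M = makerPart play
  cell-scores : ∀ {q} → q ∈ cells V → 7 ≤ length (scoringIn M q)
  cell-scores {q} q∈ = let q-base , inV = ∈-cells⁻ V q∈ in cell-score {V} {M} {q} q-base inV (pairing-covers uV follows)

-- Points far from the boundary

∣m⊖n∣≤d : ∀ {m n d} → m ≤ d → n ≤ d → ∣ m ⊖ n ∣ ≤ d
∣m⊖n∣≤d {m} {n} m≤d n≤d = ℕP.≤-trans (ℤP.∣m⊝n∣≤m⊔n m n) (ℕP.⊔-lub m≤d n≤d)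

∈-range : ∀ {d} z → ∣ z ∣ ≤ d → z ∈ range d
∈-range {d} (+ n) n≤d =
  subst (_∈ range d) value (∈-map⁺ (λ i → + i ℤ.- + d) (∈-upTo⁺ (s≤s (ℕP.+-monoˡ-≤ d n≤d))))
  where
  value : + (n + d) ℤ.- + d ≡ + n
  value = trans (ℤP.m-n≡m⊖n (n + d) d) (trans (ℤP.⊖-≥ (ℕP.m≤n+m d n)) (cong +_ (ℕP.m+n∸n≡m n d)))
∈-range {d} -[1+ n ] n<d = subst (_∈ range d) value (∈-map⁺ (λ i → + i ℤ.- + d) (∈-upTo⁺ i<2d+1))
  where
  i<d : d ∸ suc n < d
  i<d = ℕP.∸-monoʳ-< (s≤s z≤n) n<d
  i<2d+1 : d ∸ suc n < suc (d + d)
  i<2d+1 = ℕP.<-trans i<d (s≤s (ℕP.m≤m+n d d))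
  value : + (d ∸ suc n) ℤ.- + d ≡ -[1+ n ]
  value = trans (ℤP.m-n≡m⊖n (d ∸ suc n) d) (trans (ℤP.⊖-< i<d) (cong (λ k → ℤ.- + k) (ℕP.m∸[m∸n]≡n n<d)))

shift-∈-ball : ∀ {d} p x y → ∣ x ∣ ≤ d → ∣ y ∣ ≤ d → ∣ x ℤ.+ y ∣ ≤ d → shift p x y ∈ ball d p
shift-∈-ball {d} p@(a , b) x y x≤d y≤d x+y≤d =
  ∈-filter⁺ (λ q → ∣ (proj₁ q ℤ.- a) ℤ.+ (proj₂ q ℤ.- b) ∣ ℕ.≤? d)
    (∈-concatMap⁺ (λ x → map (λ y → shift p x y) (range d))
      (Any.map (λ { refl → ∈-map⁺ (λ y → shift p x y) (∈-range y y≤d) }) (∈-range x x≤d)))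
    (subst (λ z → ∣ z ∣ ≤ d) (sym (cong₂ ℤ._+_ (cancel a x) (cancel b y))) x+y≤d)
  where
  cancel : ∀ a x → a ℤ.+ x ℤ.- a ≡ x
  cancel = ℤSolver.solve-∀

BallInside : ℕ → List Pt → Pt → Set
BallInside d V p = All (_∈ V) (ball d p)

ballInside? : ∀ d V → Decidable (BallInside d V)
ballInside? d V p = all? (_∈? V) (ball d p)

interiorPoints : ℕ → List Pt → List Pt
interiorPoints d V = filter (ballInside? d V) V

numWin≤nearBoundary+3*interiorPoints : ∀ d V → numWin V ≤ nearBoundary d V + 3 * length (interiorPoints d V)
numWin≤nearBoundary+3*interiorPoints d V = begin
  numWin V                                              ≡⟨ length≡length-filter-¬+length-filter I? (winningSets V) ⟩
  nearBoundary d V + length (filter I? (winningSets V))  ≤⟨ ℕP.+-monoʳ-≤ (nearBoundary d V) interior≤ ⟩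
  nearBoundary d V + 3 * length (interiorPoints d V)    ∎
  where
  open ℕP.≤-Reasoning
  I? : Decidable (interior d V)
  I? = interior? d V
  rhombiAt : Pt → List (List Pt)
  rhombiAt p = map (rhombus p) orientations
  interior-anchor : ∀ {p} o → interior d V (rhombus p o) → BallInside d V p
  interior-anchor o₁ = All.head
  interior-anchor o₂ = All.head
  interior-anchor o₃ = All.head
  outside : ∀ p → ¬ BallInside d V p → ∀ {r} → r ∈ rhombiAt p → ¬ interior d V r
  outside p ¬inside r∈ r-interior =
    let o , _ , r≡ = ∈-map⁻ (rhombus p) {xs = orientations} r∈
    in ¬inside (interior-anchor o (subst (interior d V) r≡ r-interior))
  interior≤ : length (filter I? (winningSets V)) ≤ 3 * length (interiorPoints d V)
  interior≤ = ℕP.≤-trans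
    (length-mono-≤ (filter⁺ I? I? (λ { refl i → i }) (filter-⊆ (λ r → all? (_∈? V) r) (candidates V))))
    (length-filter-concatMap-≤ I? (ballInside? d V) rhombiAt 3 (λ _ → ℕP.≤-refl) outside V)

rowPoints : Pt → List Pt
rowPoints q = map (λ k → offset q k 0) (upTo 32)

cellBelow : Pt → Pt
cellBelow (a , b) = roundDown 32 a , b

offset-cellBelow : ∀ p k e → offset (cellBelow p) k e ≡ shift p (k ⊖ column p) (+ e)
offset-cellBelow p@(a , b) k e = cong (_, b ℤ.+ + e) (begin
  roundDown 32 a ℤ.+ + k
    ≡⟨ regroup (roundDown 32 a) (+ column p) (+ k) ⟩
  (roundDown 32 a ℤ.+ + column p) ℤ.+ (+ k ℤ.- + column p)
    ≡⟨ cong₂ ℤ._+_ (roundDown+%ℕ 32 a) (ℤP.m-n≡m⊖n k (column p)) ⟩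
  a ℤ.+ (k ⊖ column p)
    ∎)
  where
  open ≡-Reasoning
  regroup : ∀ x y z → x ℤ.+ z ≡ (x ℤ.+ y) ℤ.+ (z ℤ.- y)
  regroup = ℤSolver.solve-∀

cellBelow-∈-ball : ∀ p {k e} → k < 32 → e < 2 → offset (cellBelow p) k e ∈ ball 32 p
cellBelow-∈-ball p {k} {e} k<32 e<2 = subst (_∈ ball 32 p) (sym (offset-cellBelow p k e))
  (shift-∈-ball p (k ⊖ column p) (+ e) (∣m⊖n∣≤d (ℕP.<⇒≤ k<32) column≤32)
    (ℕP.≤-trans (ℕP.<⇒≤pred e<2) (ℕP.m≤m+n 1 31))
    (subst (λ z → ∣ z ∣ ≤ 32) (sym sum≡) (∣m⊖n∣≤d k+e≤32 column≤32)))
  where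
  column≤32 : column p ≤ 32
  column≤32 = ℕP.<⇒≤ (n%ℕd<d (proj₁ p) 32)
  k+e≤32 : k + e ≤ 32
  k+e≤32 = subst (k + e ≤_) (ℕP.+-comm 31 1) (ℕP.+-mono-≤ (ℕP.<⇒≤pred k<32) (ℕP.<⇒≤pred e<2))
  sum≡ : (k ⊖ column p) ℤ.+ + e ≡ (k + e) ⊖ column p
  sum≡ = trans (cong (ℤ._+ + e) (sym (ℤP.m-n≡m⊖n k (column p))))
           (trans (swap (+ k) (+ column p) (+ e)) (ℤP.m-n≡m⊖n (k + e) (column p)))
    where
    swap : ∀ x y z → x ℤ.- y ℤ.+ z ≡ x ℤ.+ z ℤ.- y
    swap = ℤSolver.solve-∀

cellBelow-∈-cells : ∀ {V p} → BallInside 32 V p → cellBelow p ∈ cells V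
cellBelow-∈-cells {V} {p@(a , b)} inside = ∈-filter⁺ (cell? V)
  (subst (_∈ V) (cong₂ _,_ (ℤP.+-identityʳ _) (ℤP.+-identityʳ b)) (cell-∈-V (s≤s z≤n) 0<2))
  (roundDown%ℕ≡0 32 a , All.tabulate λ z∈ →
    let k , e , k<32 , e<2 , z≡ = ∈-cellPoints⁻ (cellBelow p) z∈ in subst (_∈ V) (sym z≡) (cell-∈-V k<32 e<2))
  where
  cell-∈-V : ∀ {k e} → k < 32 → e < 2 → offset (cellBelow p) k e ∈ V
  cell-∈-V k<32 e<2 = All.lookup inside (cellBelow-∈-ball p k<32 e<2)

∈-rowPoints-cellBelow : ∀ p → p ∈ rowPoints (cellBelow p)
∈-rowPoints-cellBelow p@(a , b) = subst (_∈ rowPoints (cellBelow p)) (cong₂ _,_ (roundDown+%ℕ 32 a) (ℤP.+-identityʳ b))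
  (∈-map⁺ (λ k → offset (cellBelow p) k 0) (∈-upTo⁺ (n%ℕd<d a 32)))

interiorPoints≤32*cells : ∀ V → Unique V → length (interiorPoints 32 V) ≤ 32 * length (cells V)
interiorPoints≤32*cells V uV = ℕP.≤-trans
  (Unique[xs]∧xs⊆ys⇒|xs|≤|ys| (Unique.filter⁺ (ballInside? 32 V) uV) in-row)
  (length-concatMap-≤ rowPoints 32 (cells V) (λ _ → ℕP.≤-refl))
  where
  in-row : ∀ {p} → p ∈ interiorPoints 32 V → p ∈ concatMap rowPoints (cells V)
  in-row {p} p∈ = ∈-concatMap⁺ rowPoints (Any.map (λ { refl → ∈-rowPoints-cellBelow p })
    (cellBelow-∈-cells {V} {p} (proj₂ (∈-filter⁻ (ballInside? 32 V) {xs = V} p∈))))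

ratio-bound : ∀ k {n b i c} → k * b ≤ n → n ≤ b + 3 * i → i ≤ 32 * c → 7 * k * n ≤ 96 * k * (7 * c) + 96 * n
ratio-bound k {n} {b} {i} {c} k*b≤n n≤ i≤ = begin
  7 * k * n
    ≤⟨ ℕP.*-monoʳ-≤ (7 * k) (ℕP.≤-trans n≤ (ℕP.+-monoʳ-≤ b (ℕP.*-monoʳ-≤ 3 i≤))) ⟩
  7 * k * (b + 3 * (32 * c))          ≡⟨ expand k b c ⟩
  7 * (k * b) + 96 * k * (7 * c)      ≤⟨ ℕP.+-monoˡ-≤ (96 * k * (7 * c)) (ℕP.*-monoʳ-≤ 7 k*b≤n) ⟩
  7 * n + 96 * k * (7 * c)            ≤⟨ ℕP.+-monoˡ-≤ (96 * k * (7 * c)) (ℕP.*-monoˡ-≤ n (ℕP.m≤m+n 7 89)) ⟩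
  96 * n + 96 * k * (7 * c)           ≡⟨ ℕP.+-comm (96 * n) (96 * k * (7 * c)) ⟩
  96 * k * (7 * c) + 96 * n           ∎
  where
  open ℕP.≤-Reasoning
  expand : ∀ k b c → 7 * k * (b + 3 * (32 * c)) ≡ 7 * (k * b) + 96 * k * (7 * c)
  expand = ℕSolver.solve-∀

theorem16 : (V : ℕ → List Pt) → (∀ m → Unique (V m))
    → (∀ N → ∃[ M ] ∀ m → m ≥ M → N ≤ numWin (V m))
    → (∀ d k → ∃[ M ] ∀ m → m ≥ M → k * nearBoundary d (V m) ≤ numWin (V m))
    → ∀ k → ∃[ M ] ∀ m → m ≥ M → ∃[ t ] (SC₂≥ 3 (V m) t
        × 7 * k * numWin (V m) ≤ 96 * k * t + 96 * numWin (V m))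
theorem16 V unique _ thin k = proj₁ (thin 32 k) , λ m m≥M →
  7 * length (cells (V m)) ,
  (pairing (V m) , pairing-valid (V m) (unique m) , pairing-score (V m) (unique m)) ,
  ratio-bound k {c = length (cells (V m))} (proj₂ (thin 32 k) m m≥M)
    (numWin≤nearBoundary+3*interiorPoints 32 (V m)) (interiorPoints≤32*cells (V m) (unique m))
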